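{- Let $m\ge3$ and $n\ge4$ be integers. Then \[ \gamma_{[2]R}(C_m\Box P_n) \le \begin{cases} \frac{m}{5}(3n+4), & m\equiv0\pmod5,\\[4pt] \frac{m+4}{5}(3n+4)-9-8\left\lfloor\frac{n-2}{5}\right\rfloor, & m\equiv1\pmod5,\\[4pt] \frac{m+3}{5}(3n+4)-6-5\left\lfloor\frac{n-2}{5}\right\rfloor, & m\equiv2\pmod5,\\[4pt] \frac{m+2}{5}(3n+4)-4-2\left\lfloor\frac{n-2}{5}\right\rfloor, & m\equiv3\pmod5,\\[4pt] \frac{m+1}{5}(3n+4)-4, & m\equiv4\pmod5. \end{cases} \]
   Context: All graphs are finite and simple. For a vertex $v$ of a graph $G$, $N(v)$ denotes its open neighborhood and $N[v]=N(v)\cup\{v\}$ its closed neighborhood. For $f:V(G)\to\mathbb{N}_0$ and $S\subseteq V(G)$ write $f(S)=\sum_{u\in S}f(u)$. For a positive integer $k$, a $[k]$-Roman dominating function of $G$ is a function $f:V(G)\to\{0,1,\dots,k+1\}$ such that every vertex $v$ with $f(v)<k$ satisfies $f(N[v])\ge k+|AN(v)|$, where $AN(v)=\{u\in N(v): f(u)>0\}$. The $[k]$-Roman domination number $\gamma_{[k]R}(G)$ is the minimum of $f(V(G))$ over all $[k]$-Roman dominating functions $f$ of $G$; $\gamma_{[2]R}$ is the double Roman domination number. $C_m\Box P_n$ denotes the Cartesian product of the cycle $C_m$ ($m\ge3$) and the path $P_n$ on $n$ vertices: its vertices are pairs $(i,j)$ with $i\in\{0,\dots,m-1\}$, $j\in\{0,\dots,n-1\}$,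 and $(i,j)$ is adjacent to $(i',j')$ iff either $j=j'$ and $i-i'\equiv\pm1\pmod m$, or $i=i'$ and $|j-j'|=1$. -}

module Defs where

open import Data.Nat using (ℕ; zero; suc; _+_; _*_; _∸_; _≤_; _<_; _≡ᵇ_; _<ᵇ_; _/_; _%_)
open import Data.Bool using (Bool; true; false; _∧_; _∨_; if_then_else_)
open import Data.Fin using (Fin; toℕ)
open import Data.List using (List; map; allFin; cartesianProduct)
open import Data.Nat.ListAction using (sum)
open import Data.Product using (_×_; _,_; Σ-syntax)

-- A finite simple graph presented by an explicit duplicate-free list of its
-- vertices, a Boolean equality test and a Boolean (irreflexive, symmetric)
-- adjacency test.
record FinGraph : Set₁ where
  field
    V        : Set
    vertices : List V
    _==_     : V → V → Bool
    adj      : V → V → Bool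

module _ (G : FinGraph) where
  open FinGraph G

  weight : (V → ℕ) → ℕ
  weight f = sum (map f vertices)

  closedNbhdSum : (V → ℕ) → V → ℕ
  closedNbhdSum f v = sum (map (λ u → if (u == v) ∨ adj v u then f u else 0) vertices)

  activeNbrs : (V → ℕ) → V → ℕ
  activeNbrs f v = sum (map (λ u → if adj v u ∧ (0 <ᵇ f u) then 1 else 0) vertices)

  IsKRDF : ℕ → (V → ℕ) → Set
  IsKRDF k f = ((v : V) → f v ≤ suc k)
             × ((v : V) → f v < k → k + activeNbrs f v ≤ closedNbhdSum f v)

  -- γ_[k]R(G) ≤ B  (γ is a minimum over [k]-RDFs, so this unfolds to the
  -- existence of a [k]-RDF of weight at most B).
  γR≤ : ℕ → ℕ → Set
  γR≤ k B = Σ[ f ∈ (V → ℕ) ] (IsKRDF k f × weight f ≤ B)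

γ[_]R[_]≤_ : ℕ → FinGraph → ℕ → Set
γ[ k ]R[ G ]≤ B = γR≤ G k B

cycAdj : (m : ℕ) → Fin m → Fin m → Bool
cycAdj m i i' =
  (toℕ i' ≡ᵇ suc (toℕ i)) ∨ (toℕ i ≡ᵇ suc (toℕ i'))
  ∨ ((toℕ i ≡ᵇ m ∸ 1) ∧ (toℕ i' ≡ᵇ 0))
  ∨ ((toℕ i' ≡ᵇ m ∸ 1) ∧ (toℕ i ≡ᵇ 0))

pathAdj : (n : ℕ) → Fin n → Fin n → Bool
pathAdj n j j' = (toℕ j' ≡ᵇ suc (toℕ j)) ∨ (toℕ j ≡ᵇ suc (toℕ j'))

C_□P_ : ℕ → ℕ → FinGraph
C m □P n = record
  { V        = Fin m × Fin n
  ; vertices = cartesianProduct (allFin m) (allFin n)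
  ; _==_     = λ { (i , j) (i' , j') → (toℕ i ≡ᵇ toℕ i') ∧ (toℕ j ≡ᵇ toℕ j') }
  ; adj      = λ { (i , j) (i' , j') →
                   ((toℕ j ≡ᵇ toℕ j') ∧ cycAdj m i i')
                 ∨ ((toℕ i ≡ᵇ toℕ i') ∧ pathAdj n j j') }
  }

-- The right-hand side of Corollary 2 (all quantities are natural numbers:
-- the divisions by 5 are exact in each branch and the subtractions never
-- truncate for m ≥ 3, n ≥ 4).
cor2Bound : ℕ → ℕ → ℕ
cor2Bound m n with m % 5
... | 0 = (m / 5) * (3 * n + 4)
... | 1 = (m + 4) / 5 * (3 * n + 4) ∸ 9 ∸ 8 * ((n ∸ 2) / 5)
... | 2 = (m + 3) / 5 * (3 * n + 4) ∸ 6 ∸ 5 * ((n ∸ 2) / 5)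
... | 3 = (m + 2) / 5 * (3 * n + 4) ∸ 4 ∸ 2 * ((n ∸ 2) / 5)
... | _ = (m + 1) / 5 * (3 * n + 4) ∸ 4

{-# OPTIONS --safe #-}
-- Put 3 on the vertices (i, j) with i + 2j + c ≡ 0 (mod 5): their closed neighbourhoods tile
-- the infinite grid, so away from the boundary every other vertex has exactly one neighbour of
-- weight 3 and can get 0.  To repair the seam of the cycle when 5 ∤ m, add 3s in column 0 on
-- the rows with 2j + c ≡ e (mod 5); every vertex not next to a 3 gets 2.  This is a [2]-Roman
-- dominating function: for f(v) = 0 every active neighbour contributes at least 1 to f(N[v]) and
-- the neighbour of weight 3 contributes 2 more.  The pattern is 5-periodic in both directions, so
-- its weight on C (5a + m₀) □ P (5b + n₀) has the form W + bL + a(B + bC).  Corollary 2 thus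
-- reduces to four numerical inequalities for each of the 35 base blocks 3 ≤ m₀ < 10, 4 ≤ n₀ < 9,
-- checked by evaluation for a suitable choice of (c, e).
module Submission where

open import Defs
open import Data.Nat using (ℕ; _≤_)
open import Data.Nat using (NonZero; zero; suc; pred; _+_; _*_; _∸_; _<_; _≡ᵇ_; _<ᵇ_; _/_; _%_; z≤n; s≤s)
open import Data.Nat.Properties
open import Data.Nat.DivMod using ([m+kn]%n≡m%n; +-distrib-/-∣ʳ; m*n/n≡m; result; _divMod_)
open import Data.Nat.Divisibility using (divides)
open import Data.Nat.ListAction using (sum)
open import Data.Nat.ListAction.Properties using (sum-++)
open import Data.Nat.Tactic.RingSolver using (solve-∀)
open import Algebra.Properties.CommutativeSemigroup +-commutativeSemigroup
  using (interchange; x∙yz≈xz∙y; x∙yz≈z∙xy; xy∙z≈yz∙x)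
open import Data.Bool using (Bool; true; false; _∧_; _∨_; if_then_else_; T)
open import Data.Bool.Properties using (T-∨; T-∧; ∨-zeroʳ)
open import Data.Unit using (tt)
open import Data.Empty using (⊥-elim)
open import Relation.Nullary using (¬_)
open import Data.Fin using (Fin; toℕ; fromℕ; fromℕ<; inject₁) renaming (zero to fzero; suc to fsuc)
open import Data.Fin.Properties using (toℕ-fromℕ; toℕ-fromℕ<; toℕ-inject₁; toℕ<n; all?)
open import Data.List using (List; []; _∷_; _++_; map; allFin; tabulate; cartesianProduct)
open import Data.List.Properties using (map-++; map-∘; map-cong; map-tabulate)
open import Data.List.Membership.Propositional using (_∈_)
open import Data.List.Membership.Propositional.Properties using (∈-cartesianProduct⁺; ∈-allFin)
open import Data.List.Relation.Unary.Any using (here; there)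
open import Data.Product using (_×_; _,_; proj₁; proj₂; ∃-syntax)
open import Data.Sum using (_⊎_; inj₁; inj₂)
open import Function using (_∘_; id; Equivalence)
open import Relation.Nullary.Decidable using (Dec; _×-dec_; from-yes)
open import Relation.Binary.PropositionalEquality

≡⇒≡ᵇ≡true : ∀ {m n} → m ≡ n → (m ≡ᵇ n) ≡ true
≡⇒≡ᵇ≡true {zero}  refl = refl
≡⇒≡ᵇ≡true {suc m} refl = ≡⇒≡ᵇ≡true {m} refl

T-∨ˡ : ∀ x {y} → T x → T (x ∨ y)
T-∨ˡ true _ = tt

T-∨ʳ : ∀ x {y} → T y → T (x ∨ y)
T-∨ʳ true  _ = tt
T-∨ʳ false p = p

T-if : ∀ b {x y : Bool} → T (if b then x else y) → (T b × T x) ⊎ (¬ T b × T y)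
T-if true  t = inj₁ (tt , t)
T-if false t = inj₂ ((λ ()) , t)

T⇒if≡then : ∀ {A : Set} {b} {x y : A} → T b → (if b then x else y) ≡ x
T⇒if≡then {b = true} _ = refl

[m+n*o]+o≡m+[1+n]*o : ∀ m n o → (m + n * o) + o ≡ m + suc n * o
[m+n*o]+o≡m+[1+n]*o m n o = trans (+-assoc m (n * o) o) (cong (m +_) (+-comm (n * o) o))

sum-map-+-≤ : ∀ {A : Set} (xs : List A) {f g h : A → ℕ} → (∀ x → f x + g x ≤ h x) →
              sum (map f xs) + sum (map g xs) ≤ sum (map h xs)
sum-map-+-≤ []       _  = z≤n
sum-map-+-≤ (x ∷ xs) {f} {g} {h} le = begin
  (f x + sum (map f xs)) + (g x + sum (map g xs)) ≡⟨ interchange (f x) _ (g x) _ ⟩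
  (f x + g x) + (sum (map f xs) + sum (map g xs)) ≤⟨ +-mono-≤ (le x) (sum-map-+-≤ xs le) ⟩
  h x + sum (map h xs)                            ∎
  where open ≤-Reasoning

∈⇒≤sum-map : ∀ {A : Set} (f : A → ℕ) {xs : List A} {x} → x ∈ xs → f x ≤ sum (map f xs)
∈⇒≤sum-map f {y ∷ _}  (here refl) = m≤m+n (f y) _
∈⇒≤sum-map f {y ∷ _}  (there x∈)  = ≤-trans (∈⇒≤sum-map f x∈) (m≤n+m _ (f y))

sum-map-cartesianProduct : ∀ {A B : Set} (xs : List A) (ys : List B) (h : A × B → ℕ) →
  sum (map h (cartesianProduct xs ys)) ≡ sum (map (λ x → sum (map (λ y → h (x , y)) ys)) xs)
sum-map-cartesianProduct []       ys h = refl
sum-map-cartesianProduct (x ∷ xs) ys h = begin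
  sum (map h (map (x ,_) ys ++ cartesianProduct xs ys))
    ≡⟨ cong sum (map-++ h (map (x ,_) ys) (cartesianProduct xs ys)) ⟩
  sum (map h (map (x ,_) ys) ++ map h (cartesianProduct xs ys))
    ≡⟨ sum-++ (map h (map (x ,_) ys)) _ ⟩
  sum (map h (map (x ,_) ys)) + sum (map h (cartesianProduct xs ys))
    ≡⟨ cong₂ _+_ (cong sum (sym (map-∘ ys))) (sum-map-cartesianProduct xs ys h) ⟩
  sum (map (λ y → h (x , y)) ys) + sum (map (λ x → sum (map (λ y → h (x , y)) ys)) xs) ∎
  where open ≡-Reasoning

∑< : ℕ → (ℕ → ℕ) → ℕ
∑< zero    g = 0
∑< (suc n) g = g 0 + ∑< n (g ∘ suc)

syntax ∑< n (λ x → e) = ∑[ x < n ] e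

∑<-cong : ∀ n {g h : ℕ → ℕ} → (∀ x → g x ≡ h x) → ∑< n g ≡ ∑< n h
∑<-cong zero    g≗h = refl
∑<-cong (suc n) g≗h = cong₂ _+_ (g≗h 0) (∑<-cong n (g≗h ∘ suc))

∑<-split : ∀ a b (g : ℕ → ℕ) → ∑< (a + b) g ≡ ∑< a g + ∑[ x < b ] g (a + x)
∑<-split zero    b g = refl
∑<-split (suc a) b g = trans (cong (g 0 +_) (∑<-split a b (g ∘ suc))) (sym (+-assoc (g 0) _ _))

∑<-distrib-+ : ∀ n (g h : ℕ → ℕ) → ∑[ x < n ] (g x + h x) ≡ ∑< n g + ∑< n h
∑<-distrib-+ zero    g h = refl
∑<-distrib-+ (suc n) g h =
  trans (cong (g 0 + h 0 +_) (∑<-distrib-+ n (g ∘ suc) (h ∘ suc))) (interchange (g 0) (h 0) _ _)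

sum-tabulate-toℕ : ∀ n (g : ℕ → ℕ) → sum (tabulate {n = n} (g ∘ toℕ)) ≡ ∑< n g
sum-tabulate-toℕ zero    g = refl
sum-tabulate-toℕ (suc n) g = cong (g 0 +_) (sum-tabulate-toℕ n (g ∘ suc))

sum-map-allFin : ∀ n (g : ℕ → ℕ) → sum (map (g ∘ toℕ) (allFin n)) ≡ ∑< n g
sum-map-allFin n g = trans (cong sum (map-tabulate {n = n} id (g ∘ toℕ))) (sum-tabulate-toℕ n g)

-- Roman domination from a dominating set

indicator-split : ∀ (b a : Bool) x →
  (if a ∧ (0 <ᵇ x) then 1 else 0) + (if a then x ∸ 1 else 0) ≤ (if b ∨ a then x else 0)
indicator-split b false x       = z≤n
indicator-split b true  zero    rewrite ∨-zeroʳ b = z≤n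
indicator-split b true  (suc x) rewrite ∨-zeroʳ b = ≤-refl

module _ (G : FinGraph) where
  open FinGraph G

  k+activeNbrs≤closedNbhdSum : ∀ k (f : V → ℕ) {v w} → w ∈ vertices → T (adj v w) → f w ≡ suc k →
                               k + activeNbrs G f v ≤ closedNbhdSum G f v
  k+activeNbrs≤closedNbhdSum k f {v} {w} w∈ vw fw≡1+k = begin
    k + activeNbrs G f v                          ≡⟨ +-comm k _ ⟩
    activeNbrs G f v + k                          ≤⟨ +-monoʳ-≤ (activeNbrs G f v) k≤∑excess ⟩
    activeNbrs G f v + sum (map excess vertices)  ≤⟨ sum-map-+-≤ vertices split ⟩
    closedNbhdSum G f v                           ∎
    where
    open ≤-Reasoning
    excess : V → ℕ
    excess u = if adj v u then f u ∸ 1 else 0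
    split : ∀ u → (if adj v u ∧ (0 <ᵇ f u) then 1 else 0) + excess u
                    ≤ (if (u == v) ∨ adj v u then f u else 0)
    split u = indicator-split (u == v) (adj v u) (f u)
    excess-w : excess w ≡ k
    excess-w = trans (T⇒if≡then vw) (cong (_∸ 1) fw≡1+k)
    k≤∑excess : k ≤ sum (map excess vertices)
    k≤∑excess = subst (_≤ sum (map excess vertices)) excess-w (∈⇒≤sum-map excess w∈)

  dominationRDF : ℕ → (D dom : V → Bool) → V → ℕ
  dominationRDF k D dom v = if D v then suc k else if dom v then 0 else k

  dominationRDF-isKRDF : ∀ k (D dom : V → Bool) → (∀ w → w ∈ vertices) →
                         (∀ v → T (dom v) → ∃[ w ] T (adj v w) × T (D w)) →
                         IsKRDF G k (dominationRDF k D dom)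
  dominationRDF-isKRDF k D dom complete dominates = ≤1+k , condition
    where
    ≤1+k : ∀ v → dominationRDF k D dom v ≤ suc k
    ≤1+k v with D v | dom v
    ... | true  | _     = ≤-refl
    ... | false | true  = z≤n
    ... | false | false = n≤1+n k
    <k⇒dom : ∀ v → dominationRDF k D dom v < k → T (dom v)
    <k⇒dom v with D v | dom v
    ... | true  | _     = λ 1+k<k → ⊥-elim (<-asym (n<1+n k) 1+k<k)
    ... | false | true  = λ _ → tt
    ... | false | false = λ k<k → ⊥-elim (<-irrefl refl k<k)
    condition : ∀ v → dominationRDF k D dom v < k →
                k + activeNbrs G (dominationRDF k D dom) v ≤ closedNbhdSum G (dominationRDF k D dom) v
    condition v fv<k with dominates v (<k⇒dom v fv<k)
    ... | w , vw , Dw = k+activeNbrs≤closedNbhdSum k (dominationRDF k D dom) (complete w) vw (T⇒if≡then Dw)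

∈-gridVertices : ∀ {M N} (v : Fin M × Fin N) → v ∈ FinGraph.vertices (C M □P N)
∈-gridVertices (i , j) = ∈-cartesianProduct⁺ (∈-allFin i) (∈-allFin j)

weight-grid : ∀ M N (g : ℕ → ℕ → ℕ) →
  weight (C M □P N) (λ v → g (toℕ (proj₁ v)) (toℕ (proj₂ v))) ≡ ∑[ i < M ] ∑[ j < N ] g i j
weight-grid M N g = begin
  weight (C M □P N) (λ v → g (toℕ (proj₁ v)) (toℕ (proj₂ v)))
    ≡⟨ sum-map-cartesianProduct (allFin M) (allFin N) _ ⟩
  sum (map (λ i → sum (map (λ j → g (toℕ i) (toℕ j)) (allFin N))) (allFin M))
    ≡⟨ cong sum (map-cong (λ i → sum-map-allFin N (g (toℕ i))) (allFin M)) ⟩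
  sum (map (λ i → ∑< N (g (toℕ i))) (allFin M))
    ≡⟨ sum-map-allFin M (λ i → ∑< N (g i)) ⟩
  ∑[ i < M ] ∑[ j < N ] g i j ∎
  where open ≡-Reasoning

module _ {M : ℕ} {i i' : Fin M} where
  cycAdj-suc : toℕ i' ≡ suc (toℕ i) → T (cycAdj M i i')
  cycAdj-suc eq rewrite ≡⇒≡ᵇ≡true eq = tt

  cycAdj-pred : toℕ i ≡ suc (toℕ i') → T (cycAdj M i i')
  cycAdj-pred eq rewrite ≡⇒≡ᵇ≡true eq = T-∨ʳ (toℕ i' ≡ᵇ suc (toℕ i)) tt

  cycAdj-last : toℕ i ≡ M ∸ 1 → toℕ i' ≡ 0 → T (cycAdj M i i')
  cycAdj-last eq eq' rewrite ≡⇒≡ᵇ≡true eq | ≡⇒≡ᵇ≡true eq' =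
    T-∨ʳ (toℕ i' ≡ᵇ suc (toℕ i)) (T-∨ʳ (toℕ i ≡ᵇ suc (toℕ i')) tt)

  cycAdj-first : toℕ i ≡ 0 → toℕ i' ≡ M ∸ 1 → T (cycAdj M i i')
  cycAdj-first eq eq' rewrite ≡⇒≡ᵇ≡true eq | ≡⇒≡ᵇ≡true eq' =
    T-∨ʳ (toℕ i' ≡ᵇ suc (toℕ i)) (T-∨ʳ (toℕ i ≡ᵇ suc (toℕ i'))
      (T-∨ʳ ((toℕ i ≡ᵇ M ∸ 1) ∧ (toℕ i' ≡ᵇ 0)) tt))

module _ {N : ℕ} {j j' : Fin N} where
  pathAdj-suc : toℕ j' ≡ suc (toℕ j) → T (pathAdj N j j')
  pathAdj-suc eq rewrite ≡⇒≡ᵇ≡true eq = tt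

  pathAdj-pred : toℕ j ≡ suc (toℕ j') → T (pathAdj N j j')
  pathAdj-pred eq rewrite ≡⇒≡ᵇ≡true eq = T-∨ʳ (toℕ j' ≡ᵇ suc (toℕ j)) tt

module _ {M N : ℕ} where
  open FinGraph (C M □P N) using (adj)

  adj-horizontal : ∀ (i i' : Fin M) (j : Fin N) → T (cycAdj M i i') → T (adj (i , j) (i' , j))
  adj-horizontal i i' j ii' rewrite ≡⇒≡ᵇ≡true (refl {x = toℕ j}) = T-∨ˡ (cycAdj M i i') ii'

  adj-vertical : ∀ (i : Fin M) (j j' : Fin N) → T (pathAdj N j j') → T (adj (i , j) (i , j'))
  adj-vertical i j j' jj' rewrite ≡⇒≡ᵇ≡true (refl {x = toℕ i}) =
    T-∨ʳ ((toℕ j ≡ᵇ toℕ j') ∧ cycAdj M i i) jj'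

-- The bound of Corollary 2

-- For r = m mod 5, cor2Bound m n = ⌈m/5⌉ (3n + 4) ∸ saving r ∸ savingRate r * ⌊(n − 2)/5⌋,
-- where ⌈m/5⌉ = (m + pad5 r) / 5.
pad5 saving savingRate : ℕ → ℕ
pad5 0 = 0
pad5 1 = 4
pad5 2 = 3
pad5 3 = 2
pad5 _ = 1
saving 0 = 0
saving 1 = 9
saving 2 = 6
saving 3 = 4
saving _ = 4
savingRate 0 = 0
savingRate 1 = 8
savingRate 2 = 5
savingRate 3 = 2
savingRate _ = 0

cor2Form : (r P K t : ℕ) → ℕ
cor2Form r P K t = P * K ∸ saving r ∸ savingRate r * t

cor2Bound≡cor2Form : ∀ m n →
  cor2Bound m n ≡ cor2Form (m % 5) ((m + pad5 (m % 5)) / 5) (3 * n + 4) ((n ∸ 2) / 5)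
cor2Bound≡cor2Form m n with m % 5
... | 0                         = cong (λ x → x / 5 * (3 * n + 4)) (sym (+-identityʳ m))
... | 1                         = refl
... | 2                         = refl
... | 3                         = refl
... | suc (suc (suc (suc _))) = refl

[m+kn]/n≡m/n+k : ∀ m k n .{{_ : NonZero n}} → (m + k * n) / n ≡ m / n + k
[m+kn]/n≡m/n+k m k n = trans (+-distrib-/-∣ʳ m (divides k refl)) (cong (m / n +_) (m*n/n≡m k n))

cor2Bound-blocks : ∀ a b m₀ n₀ → 2 ≤ n₀ →
  cor2Bound (a * 5 + m₀) (b * 5 + n₀)
    ≡ cor2Form (m₀ % 5) ((m₀ + pad5 (m₀ % 5)) / 5 + a) ((3 * n₀ + 4) + 15 * b) ((n₀ ∸ 2) / 5 + b)
cor2Bound-blocks a b m₀ n₀ 2≤n₀ = begin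
  cor2Bound m n
    ≡⟨ cor2Bound≡cor2Form m n ⟩
  cor2Form (m % 5) ((m + pad5 (m % 5)) / 5) (3 * n + 4) ((n ∸ 2) / 5)
    ≡⟨ cong (λ r → cor2Form r ((m + pad5 r) / 5) (3 * n + 4) ((n ∸ 2) / 5)) residue ⟩
  cor2Form r ((m + pad5 r) / 5) (3 * n + 4) ((n ∸ 2) / 5)
    ≡⟨ cong (λ P → cor2Form r P (3 * n + 4) ((n ∸ 2) / 5)) columns ⟩
  cor2Form r ((m₀ + pad5 r) / 5 + a) (3 * n + 4) ((n ∸ 2) / 5)
    ≡⟨ cong (λ K → cor2Form r ((m₀ + pad5 r) / 5 + a) K ((n ∸ 2) / 5)) (rowsLinear b n₀) ⟩
  cor2Form r ((m₀ + pad5 r) / 5 + a) ((3 * n₀ + 4) + 15 * b) ((n ∸ 2) / 5)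
    ≡⟨ cong (cor2Form r ((m₀ + pad5 r) / 5 + a) ((3 * n₀ + 4) + 15 * b)) rows ⟩
  cor2Form r ((m₀ + pad5 r) / 5 + a) ((3 * n₀ + 4) + 15 * b) ((n₀ ∸ 2) / 5 + b) ∎
  where
  open ≡-Reasoning
  m = a * 5 + m₀
  n = b * 5 + n₀
  r = m₀ % 5
  residue : m % 5 ≡ r
  residue = trans (cong (_% 5) (+-comm (a * 5) m₀)) ([m+kn]%n≡m%n m₀ a 5)
  columns : (m + pad5 r) / 5 ≡ (m₀ + pad5 r) / 5 + a
  columns = trans (cong (_/ 5) (xy∙z≈yz∙x (a * 5) m₀ (pad5 r))) ([m+kn]/n≡m/n+k (m₀ + pad5 r) a 5)
  rowsLinear : ∀ b n₀ → 3 * (b * 5 + n₀) + 4 ≡ (3 * n₀ + 4) + 15 * b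
  rowsLinear = solve-∀
  rows : (n ∸ 2) / 5 ≡ (n₀ ∸ 2) / 5 + b
  rows = trans (cong (_/ 5) (trans (+-∸-assoc (b * 5) 2≤n₀) (+-comm (b * 5) (n₀ ∸ 2))))
               ([m+kn]/n≡m/n+k (n₀ ∸ 2) b 5)

cor2Form-blocks : ∀ {r P K t w L B C} a b →
  w + saving r + savingRate r * t ≤ P * K → L + savingRate r ≤ 15 * P → B ≤ K → C ≤ 15 →
  (w + b * L) + a * (B + b * C) ≤ cor2Form r (P + a) (K + 15 * b) (t + b)
cor2Form-blocks {r} {P} {K} {t} {w} {L} {B} {C} a b base rows columns corner =
  subst (w + b * L + a * (B + b * C) ≤_) (sym (∸-+-assoc ((P + a) * (K + 15 * b)) Y (D * (t + b))))
    (m+n≤o⇒m≤o∸n (w + b * L + a * (B + b * C)) (begin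
      w + b * L + a * (B + b * C) + (Y + D * (t + b))   ≡⟨ regroup w L B C a b Y D t ⟩
      (w + Y + D * t) + b * (L + D) + a * (B + b * C)
        ≤⟨ +-mono-≤ (+-mono-≤ base (*-monoʳ-≤ b rows)) (*-monoʳ-≤ a (+-mono-≤ columns (*-monoʳ-≤ b corner))) ⟩
      P * K + b * (15 * P) + a * (K + b * 15)           ≡⟨ expand P K a b ⟩
      (P + a) * (K + 15 * b)                            ∎))
  where
  open ≤-Reasoning
  Y = saving r
  D = savingRate r
  regroup : ∀ w L B C a b Y D t →
    w + b * L + a * (B + b * C) + (Y + D * (t + b)) ≡ (w + Y + D * t) + b * (L + D) + a * (B + b * C)
  regroup = solve-∀
  expand : ∀ P K a b → P * K + b * (15 * P) + a * (K + b * 15) ≡ (P + a) * (K + 15 * b)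
  expand = solve-∀

-- The diagonal pattern

-- c shifts the diagonal lattice and e selects the residue of the seam rows; e = 5 means no seam.
module DiagonalPattern (c e : ℕ) where

  three : (N i j : ℕ) → Bool
  three N i j = ((i + (j * 2 + c) % 5) % 5 ≡ᵇ 0)
              ∨ ((i ≡ᵇ 0) ∧ ((j * 2 + c) % 5 ≡ᵇ e) ∧ (suc j <ᵇ N))

  -- Written with if and ∧ rather than by matching on i or j, so that value M N i j unfolds for
  -- symbolic i, j: the periodicity lemmas below then hold by computation.
  leftThree : (M N i j : ℕ) → Bool
  leftThree M N i j = if i ≡ᵇ 0 then three N (pred M) j else three N (pred i) j

  rightThree : (M N i j : ℕ) → Bool
  rightThree M N i j = if suc i ≡ᵇ M then three N 0 j else three N (suc i) j

  upThree : (N i j : ℕ) → Bool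
  upThree N i j = (0 <ᵇ j) ∧ three N i (pred j)

  downThree : (N i j : ℕ) → Bool
  downThree N i j = (suc j <ᵇ N) ∧ three N i (suc j)

  dominated : (M N i j : ℕ) → Bool
  dominated M N i j = leftThree M N i j ∨ rightThree M N i j ∨ upThree N i j ∨ downThree N i j

  value : (M N i j : ℕ) → ℕ
  value M N i j = if three N i j then 3 else if dominated M N i j then 0 else 2

  module _ {M N : ℕ} where
    open FinGraph (C M □P N) using (V; adj)

    isThree : V → Bool
    isThree (i , j) = three N (toℕ i) (toℕ j)

    isDominated : V → Bool
    isDominated (i , j) = dominated M N (toℕ i) (toℕ j)

    ThreeNeighbour : V → Set
    ThreeNeighbour v = ∃[ w ] T (adj v w) × T (isThree w)

    threeNeighbour : ∀ v w → T (adj v w) → ∀ {x y} → toℕ (proj₁ w) ≡ x → toℕ (proj₂ w) ≡ y →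
                     T (three N x y) → ThreeNeighbour v
    threeNeighbour v w vw refl refl t = w , vw , t

  leftNeighbour : ∀ {M N} (i : Fin M) (j : Fin N) → T (leftThree M N (toℕ i) (toℕ j)) →
                  ThreeNeighbour (i , j)
  leftNeighbour {suc M} fzero j t =
    threeNeighbour (fzero , j) (fromℕ M , j)
      (adj-horizontal fzero (fromℕ M) j (cycAdj-first refl (toℕ-fromℕ M))) (toℕ-fromℕ M) refl t
  leftNeighbour (fsuc i) j t =
    threeNeighbour (fsuc i , j) (inject₁ i , j)
      (adj-horizontal (fsuc i) (inject₁ i) j (cycAdj-pred (cong suc (sym (toℕ-inject₁ i)))))
      (toℕ-inject₁ i) refl t

  rightNeighbour : ∀ {M N} (i : Fin M) (j : Fin N) → T (rightThree M N (toℕ i) (toℕ j)) →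
                   ThreeNeighbour (i , j)
  rightNeighbour {suc M} i j t with T-if (suc (toℕ i) ≡ᵇ suc M) t
  ... | inj₁ (wraps , t') =
    threeNeighbour (i , j) (fzero , j)
      (adj-horizontal i fzero j (cycAdj-last (≡ᵇ⇒≡ (toℕ i) M wraps) refl)) refl refl t'
  ... | inj₂ (¬wraps , t') =
    threeNeighbour (i , j) (fromℕ< i+1<M , j)
      (adj-horizontal i (fromℕ< i+1<M) j (cycAdj-suc (toℕ-fromℕ< i+1<M))) (toℕ-fromℕ< i+1<M) refl t'
    where
    i+1<M : suc (toℕ i) < suc M
    i+1<M = ≤∧≢⇒< (toℕ<n i) (¬wraps ∘ ≡⇒≡ᵇ _ _)

  upNeighbour : ∀ {M N} (i : Fin M) (j : Fin N) → T (upThree N (toℕ i) (toℕ j)) → ThreeNeighbour (i , j)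
  upNeighbour i (fsuc j) t =
    threeNeighbour (i , fsuc j) (i , inject₁ j)
      (adj-vertical i (fsuc j) (inject₁ j) (pathAdj-pred (cong suc (sym (toℕ-inject₁ j)))))
      refl (toℕ-inject₁ j) t

  downNeighbour : ∀ {M N} (i : Fin M) (j : Fin N) → T (downThree N (toℕ i) (toℕ j)) → ThreeNeighbour (i , j)
  downNeighbour {N = N} i j t with Equivalence.to T-∧ t
  ... | j+1<ᵇN , t' =
    threeNeighbour (i , j) (i , fromℕ< j+1<N)
      (adj-vertical i j (fromℕ< j+1<N) (pathAdj-suc (toℕ-fromℕ< j+1<N))) refl (toℕ-fromℕ< j+1<N) t'
    where
    j+1<N : suc (toℕ j) < N
    j+1<N = <ᵇ⇒< _ _ j+1<ᵇN

  dominated⇒threeNeighbour : ∀ {M N} (v : Fin M × Fin N) → T (isDominated v) → ThreeNeighbour v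
  dominated⇒threeNeighbour (i , j) d with Equivalence.to T-∨ d
  ... | inj₁ l = leftNeighbour i j l
  ... | inj₂ d' with Equivalence.to T-∨ d'
  ... | inj₁ r = rightNeighbour i j r
  ... | inj₂ d'' with Equivalence.to T-∨ d''
  ... | inj₁ u = upNeighbour i j u
  ... | inj₂ b = downNeighbour i j b

  patternRDF : (M N : ℕ) → Fin M × Fin N → ℕ
  patternRDF M N = dominationRDF (C M □P N) 2 isThree isDominated

  patternRDF-isKRDF : ∀ M N → IsKRDF (C M □P N) 2 (patternRDF M N)
  patternRDF-isKRDF M N =
    dominationRDF-isKRDF (C M □P N) 2 isThree isDominated ∈-gridVertices dominated⇒threeNeighbour

  window : (M N i₀ w j₀ h : ℕ) → ℕ
  window M N i₀ w j₀ h = ∑[ x < w ] ∑[ y < h ] value M N (i₀ + x) (j₀ + y)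

  weight-patternRDF : ∀ M N → weight (C M □P N) (patternRDF M N) ≡ window M N 0 M 0 N
  weight-patternRDF M N = weight-grid M N (value M N)

  -- In the (5 + N)-row pattern, row 0 agrees with row 0 of the N-row one, rows 1–5 with those of
  -- the 9-row one, and row 5 + j with row j of the N-row one for j ≥ 1, all definitionally:
  -- (10 + x) % 5 reduces to x % 5.
  column-add5Rows : ∀ M i {N} → 3 ≤ N →
    ∑[ y < 5 + N ] value M (5 + N) i y ≡ ∑[ y < N ] value M N i y + ∑[ y < 5 ] value M 9 i (1 + y)
  column-add5Rows M i (s≤s (s≤s (s≤s (z≤n {n = N})))) =
    trans (cong (value M (8 + N) i 0 +_) (∑<-split 5 (2 + N) (λ y → value M (8 + N) i (suc y))))
          (x∙yz≈xz∙y (value M (3 + N) i 0) _ _)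

  window-addRowBlocks : ∀ M i₀ w b {N} → 3 ≤ N →
    window M (b * 5 + N) i₀ w 0 (b * 5 + N) ≡ window M N i₀ w 0 N + b * window M 9 i₀ w 1 5
  window-addRowBlocks M i₀ w zero    _   = sym (+-identityʳ _)
  window-addRowBlocks M i₀ w (suc b) {N} 3≤N = begin
    window M (5 + (b * 5 + N)) i₀ w 0 (5 + (b * 5 + N))
      ≡⟨ ∑<-cong w (λ x → column-add5Rows M (i₀ + x) (≤-trans 3≤N (m≤n+m N (b * 5)))) ⟩
    ∑[ x < w ] (∑[ y < b * 5 + N ] value M (b * 5 + N) (i₀ + x) y + ∑[ y < 5 ] value M 9 (i₀ + x) (1 + y))
      ≡⟨ ∑<-distrib-+ w _ _ ⟩
    window M (b * 5 + N) i₀ w 0 (b * 5 + N) + window M 9 i₀ w 1 5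
      ≡⟨ cong (_+ window M 9 i₀ w 1 5) (window-addRowBlocks M i₀ w b 3≤N) ⟩
    window M N i₀ w 0 N + b * window M 9 i₀ w 1 5 + window M 9 i₀ w 1 5
      ≡⟨ [m+n*o]+o≡m+[1+n]*o (window M N i₀ w 0 N) b (window M 9 i₀ w 1 5) ⟩
    window M N i₀ w 0 N + suc b * window M 9 i₀ w 1 5 ∎
    where open ≡-Reasoning

  -- Likewise, in the (5 + M)-column pattern, columns 0–3 agree with those of the M-column one
  -- (they see M only through (M − 1) mod 5), columns 4–8 with those of the 10-column one, and
  -- column 5 + i with column i of the M-column one for i ≥ 4.
  grid-add5Columns : ∀ {M} N → 5 ≤ M →
    window (5 + M) N 0 (5 + M) 0 N ≡ window M N 0 M 0 N + window 10 N 4 5 0 N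
  grid-add5Columns N (s≤s (s≤s (s≤s (s≤s (s≤s (z≤n {n = M})))))) =
    trans (∑<-split 4 (5 + (1 + M)) (column (10 + M)))
    (trans (cong (∑< 4 (column (10 + M)) +_) (∑<-split 5 (1 + M) (λ x → column (10 + M) (4 + x))))
    (trans (x∙yz≈xz∙y (∑< 4 (column (5 + M))) _ _)
           (cong (_+ window 10 N 4 5 0 N) (sym (∑<-split 4 (1 + M) (column (5 + M)))))))
    where
    column : ℕ → ℕ → ℕ
    column M' i = ∑[ y < N ] value M' N i y

  grid-addColumnBlocks : ∀ a {M} N → 5 ≤ M ⊎ a ≡ 0 →
    window (a * 5 + M) N 0 (a * 5 + M) 0 N ≡ window M N 0 M 0 N + a * window 10 N 4 5 0 N
  grid-addColumnBlocks zero    N _ = sym (+-identityʳ _)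
  grid-addColumnBlocks (suc a) {M} N (inj₁ 5≤M) = begin
    window (5 + (a * 5 + M)) N 0 (5 + (a * 5 + M)) 0 N
      ≡⟨ grid-add5Columns N (≤-trans 5≤M (m≤n+m M (a * 5))) ⟩
    window (a * 5 + M) N 0 (a * 5 + M) 0 N + window 10 N 4 5 0 N
      ≡⟨ cong (_+ window 10 N 4 5 0 N) (grid-addColumnBlocks a N (inj₁ 5≤M)) ⟩
    window M N 0 M 0 N + a * window 10 N 4 5 0 N + window 10 N 4 5 0 N
      ≡⟨ [m+n*o]+o≡m+[1+n]*o (window M N 0 M 0 N) a (window 10 N 4 5 0 N) ⟩
    window M N 0 M 0 N + suc a * window 10 N 4 5 0 N ∎
    where open ≡-Reasoning

  grid-blocks : ∀ a b {m₀ n₀} → 5 ≤ m₀ ⊎ a ≡ 0 → 3 ≤ n₀ →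
    window (a * 5 + m₀) (b * 5 + n₀) 0 (a * 5 + m₀) 0 (b * 5 + n₀)
      ≡ (window m₀ n₀ 0 m₀ 0 n₀ + b * window m₀ 9 0 m₀ 1 5)
        + a * (window 10 n₀ 4 5 0 n₀ + b * window 10 9 4 5 1 5)
  grid-blocks a b {m₀} {n₀} columns 3≤n₀ =
    trans (grid-addColumnBlocks a (b * 5 + n₀) columns)
          (cong₂ (λ u v → u + a * v) (window-addRowBlocks m₀ 0 m₀ b 3≤n₀)
                                     (window-addRowBlocks 10 4 5 b 3≤n₀))

  BaseChecks : (m₀ n₀ : ℕ) → Set
  BaseChecks m₀ n₀ =
    let r = m₀ % 5 ; P = (m₀ + pad5 r) / 5 ; K = 3 * n₀ + 4 in
    window m₀ n₀ 0 m₀ 0 n₀ + saving r + savingRate r * ((n₀ ∸ 2) / 5) ≤ P * K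
    × window m₀ 9 0 m₀ 1 5 + savingRate r ≤ 15 * P
    × window 10 n₀ 4 5 0 n₀ ≤ K
    × window 10 9 4 5 1 5 ≤ 15

  baseChecks? : ∀ m₀ n₀ → Dec (BaseChecks m₀ n₀)
  baseChecks? m₀ n₀ = (_ ≤? _) ×-dec (_ ≤? _) ×-dec (_ ≤? _) ×-dec (_ ≤? _)

  γ≤cor2Bound : ∀ a b {m₀ n₀} → 5 ≤ m₀ ⊎ a ≡ 0 → 3 ≤ n₀ → BaseChecks m₀ n₀ →
                γ[ 2 ]R[ C (a * 5 + m₀) □P (b * 5 + n₀) ]≤ cor2Bound (a * 5 + m₀) (b * 5 + n₀)
  γ≤cor2Bound a b {m₀} {n₀} columns 3≤n₀ (base , rowBlock , columnBlock , cornerBlock) =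
    patternRDF m n , patternRDF-isKRDF m n , (begin
      weight (C m □P n) (patternRDF m n)  ≡⟨ weight-patternRDF m n ⟩
      window m n 0 m 0 n                  ≡⟨ grid-blocks a b columns 3≤n₀ ⟩
      _                                   ≤⟨ cor2Form-blocks {P = (m₀ + pad5 (m₀ % 5)) / 5} a b
                                                            base rowBlock columnBlock cornerBlock ⟩
      _                                   ≡⟨ cor2Bound-blocks a b m₀ n₀ (<⇒≤ 3≤n₀) ⟨
      cor2Bound m n                       ∎)
    where
    open ≤-Reasoning
    m = a * 5 + m₀
    n = b * 5 + n₀

-- (c, e) as a function of m mod 5 and n mod 5, found by a search over c < 5, e ≤ 5.
seamParams : ℕ → ℕ → ℕ × ℕ
seamParams 0 _ = 0 , 5
seamParams 1 _ = 2 , 4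
seamParams 2 _ = 0 , 3
seamParams 3 3 = 0 , 5
seamParams 3 _ = 3 , 5
seamParams _ 0 = 1 , 1
seamParams _ 3 = 1 , 1
seamParams _ _ = 3 , 1

Feasible : ℕ → ℕ → Set
Feasible m₀ n₀ = let c , e = seamParams (m₀ % 5) (n₀ % 5) in DiagonalPattern.BaseChecks c e m₀ n₀

feasible? : ∀ m₀ n₀ → Dec (Feasible m₀ n₀)
feasible? m₀ n₀ = let c , e = seamParams (m₀ % 5) (n₀ % 5) in DiagonalPattern.baseChecks? c e m₀ n₀

feasible⇒γ≤cor2Bound : ∀ a b {m₀ n₀} → 5 ≤ m₀ ⊎ a ≡ 0 → 3 ≤ n₀ → Feasible m₀ n₀ →
                       γ[ 2 ]R[ C (a * 5 + m₀) □P (b * 5 + n₀) ]≤ cor2Bound (a * 5 + m₀) (b * 5 + n₀)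
feasible⇒γ≤cor2Bound a b {m₀} {n₀} =
  let c , e = seamParams (m₀ % 5) (n₀ % 5) in DiagonalPattern.γ≤cor2Bound c e a b

feasible-bases : ∀ (p : Fin 7) (s : Fin 5) → Feasible (3 + toℕ p) (4 + toℕ s)
feasible-bases = from-yes (all? {n = 7} λ p → all? {n = 5} λ s → feasible? (3 + toℕ p) (4 + toℕ s))

columnDecomposition : ∀ m → 3 ≤ m →
                      ∃[ a ] ∃[ p ] (5 ≤ 3 + toℕ {7} p ⊎ a ≡ 0) × m ≡ a * 5 + (3 + toℕ p)
columnDecomposition 1 (s≤s ())
columnDecomposition 2 (s≤s (s≤s ()))
columnDecomposition 3 _ = 0 , fzero , inj₂ refl , refl
columnDecomposition 4 _ = 0 , fsuc fzero , inj₂ refl , refl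
columnDecomposition (suc (suc (suc (suc (suc m))))) _ with m divMod 5
... | result a r m≡ =
  a , fsuc (fsuc r) , inj₁ (m≤m+n 5 (toℕ r)) , trans (cong (5 +_) m≡) (x∙yz≈z∙xy 5 (toℕ r) (a * 5))

rowDecomposition : ∀ n → 4 ≤ n → ∃[ b ] ∃[ s ] n ≡ b * 5 + (4 + toℕ {5} s)
rowDecomposition 1 (s≤s ())
rowDecomposition 2 (s≤s (s≤s ()))
rowDecomposition 3 (s≤s (s≤s (s≤s ())))
rowDecomposition (suc (suc (suc (suc n)))) _ with n divMod 5
... | result b s n≡ = b , s , trans (cong (4 +_) n≡) (x∙yz≈z∙xy 4 (toℕ s) (b * 5))

corollary2 : (m n : ℕ) → 3 ≤ m → 4 ≤ n → γ[ 2 ]R[ C m □P n ]≤ cor2Bound m n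
corollary2 m n 3≤m 4≤n with columnDecomposition m 3≤m | rowDecomposition n 4≤n
... | a , p , columns , refl | b , s , refl =
  feasible⇒γ≤cor2Bound a b columns (s≤s (s≤s (s≤s z≤n))) (feasible-bases p s)
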